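{- Let $k$ be an odd positive integer and let $\zeta$ be a primitive $2k$-th root of unity. Let $Q_k$ denote the set of quasipolarities of $\mathbb{Z}/2k\mathbb{Z}$. Then \[ \sum_{\pi\in Q_{k}}\prod_{j=0}^{2k-1}\frac{1+\zeta^{j-\pi(j)}}{1-\zeta^{j-\pi(j)}} = 0. \]
   Context: The affine general linear group $\overrightarrow{GL}(\mathbb{Z}/2k\mathbb{Z})$ consists of the maps $e^{u}.v:\mathbb{Z}/2k\mathbb{Z}\to\mathbb{Z}/2k\mathbb{Z}$, $x\mapsto vx+u$, with $u\in\mathbb{Z}/2k\mathbb{Z}$ and $v\in(\mathbb{Z}/2k\mathbb{Z})^{\times}$. A quasipolarity is an element $\pi$ of this group that is an involution ($\pi\circ\pi=\mathrm{id}$) and a derangement ($\pi(j)\neq j$ for all $j$). Elements of $\mathbb{Z}/2k\mathbb{Z}$ are identified with $0,1,\dots,2k-1$, and $\zeta^{j-\pi(j)}$ is well defined since $\zeta^{2k}=1$; the denominators are nonzero because $\pi$ has no fixed points. -}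

module Defs where

open import Level using (Level; _⊔_) renaming (suc to lsuc)
open import Algebra.Bundles using (CommutativeRing)
open import Data.Nat as ℕ using (ℕ; zero; suc; _<_; _≟_)
open import Data.Nat.DivMod using (_%_)
open import Data.Nat.GCD using (gcd)
open import Data.Product using (_×_; _,_)
open import Data.List using (List; []; _∷_; map; filter; concatMap; upTo; foldr)
open import Data.List.Relation.Unary.All using (All; all?)
open import Relation.Nullary using (¬_; ¬?)
open import Relation.Nullary.Decidable using (_×-dec_)
open import Relation.Binary.PropositionalEquality using (_≡_; _≢_)

-- Fields (stdlib has no plain Field bundle): a commutative ring with a
-- total inverse function that is a genuine inverse on nonzero elements,
-- and 0 ≠ 1.  (The value of 0⁻¹ is irrelevant/unspecified.)

record Field (c ℓ : Level) : Set (lsuc (c ⊔ ℓ)) where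
  field
    commutativeRing : CommutativeRing c ℓ
  open CommutativeRing commutativeRing public
  field
    _⁻¹       : Carrier → Carrier
    ⁻¹-cong   : ∀ {x y} → x ≈ y → (x ⁻¹) ≈ (y ⁻¹)
    inverseʳ  : ∀ x → ¬ (x ≈ 0#) → (x * (x ⁻¹)) ≈ 1#
    0≉1       : ¬ (0# ≈ 1#)

  _^_ : Carrier → ℕ → Carrier
  x ^ zero  = 1#
  x ^ suc m = x * (x ^ m)

  fromℕ : ℕ → Carrier
  fromℕ zero    = 0#
  fromℕ (suc m) = 1# + fromℕ m

  sumL : List Carrier → Carrier
  sumL = foldr _+_ 0#

  prodL : List Carrier → Carrier
  prodL = foldr _*_ 1#

  CharZero : Set ℓ
  CharZero = ∀ m → ¬ (m ≡ 0) → ¬ (fromℕ m ≈ 0#)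

  PrimitiveRoot : ℕ → Carrier → Set ℓ
  PrimitiveRoot n ζ = ((ζ ^ n) ≈ 1#) × (∀ m → 0 < m → m < n → ¬ ((ζ ^ m) ≈ 1#))

-- ℤ/nℤ represented by {0,…,n-1}

modN : ℕ → ℕ → ℕ
modN zero    a = a
modN (suc n) a = a % suc n

-- the affine map e^u.v : x ↦ v x + u, encoded by the pair (u , v)
Affine : Set
Affine = ℕ × ℕ

app : (n : ℕ) → Affine → ℕ → ℕ
app n (u , v) x = modN n ((v ℕ.* x) ℕ.+ u)

units : ℕ → List ℕ
units n = filter (λ v → gcd v n ≟ 1) (upTo n)

affineGroup : ℕ → List Affine
affineGroup n = concatMap (λ u → map (λ v → (u , v)) (units n)) (upTo n)

IsQuasipolarity : ℕ → Affine → Set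
IsQuasipolarity n π =
  All (λ j → (app n π (app n π j) ≡ j) × (app n π j ≢ j)) (upTo n)

isQuasipolarity? : (n : ℕ) → (π : Affine) → Relation.Nullary.Dec (IsQuasipolarity n π)
isQuasipolarity? n π =
  all? (λ j → (app n π (app n π j) ≟ j) ×-dec ¬? (app n π j ≟ j)) (upTo n)

-- Q_k as a list (for n = 2k); distinct pairs give distinct maps
quasipolarities : ℕ → List Affine
quasipolarities n = filter (isQuasipolarity? n) (affineGroup n)

-- the representative of j - π(j) in {0..n-1}
diffExp : (n : ℕ) → Affine → ℕ → ℕ
diffExp n π j = modN n ((j ℕ.+ n) ℕ.∸ app n π j)

module _ {c ℓ} (F : Field c ℓ) where
  open Field F

  quasipolaritySum : ℕ → Carrier → Carrier
  quasipolaritySum n ζ =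
    sumL (map (λ π → prodL (map (λ j →
             (1# + (ζ ^ diffExp n π j)) * ((1# - (ζ ^ diffExp n π j)) ⁻¹))
           (upTo n)))
         (quasipolarities n))

-- Every summand vanishes. Write π(x) = v x + u on ℤ/2k. Since π swaps 0 and u = π(0), we have
-- v u ≡ -u, so modulo k (where 2 is invertible, k being odd) π fixes the midpoint j ≡ u/2 of 0 and u:
-- π(j) ≡ -u/2 + u ≡ j. As π has no fixed point, π(j) = j + k in ℤ/2k, so the j-th factor of the
-- product contains 1 + ζ^k, which is 0 because ζ^k is a square root of 1 other than 1.
module Submission where

open import Defs
import Data.Nat as ℕ
import Data.Nat.Properties as ℕₚ
open import Data.Nat.Base using (ℕ; zero; suc)
open import Data.Product using (∃-syntax; _×_; _,_; proj₁; proj₂)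
open import Data.List using (map; upTo)
open import Data.List.Membership.Propositional using (_∈_)
open import Data.List.Membership.Propositional.Properties using (∈-upTo⁺)
open import Data.List.Relation.Unary.Any using (here; there)
open import Data.List.Relation.Unary.All as All using (All; []; _∷_)
open import Data.List.Relation.Unary.All.Properties using (all-filter)
open import Relation.Binary.PropositionalEquality as ≡ using (_≡_; cong)
open import Relation.Nullary using (contradiction)

module _ where
  open import Data.Nat using (_+_; _*_; _∸_; _<_; _%_; z≤n; s≤s; NonZero)
  open import Data.Nat.Divisibility using (_∣_; divides; m%n≡0⇒n∣m)
  open import Data.Nat.Properties
  open ≡.≡-Reasoning

  m∣n∧0<n∧n<2m⇒n≡m : ∀ {m n} → m ∣ n → 0 < n → n < 2 * m → n ≡ m
  m∣n∧0<n∧n<2m⇒n≡m (divides zero ≡.refl) () _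
  m∣n∧0<n∧n<2m⇒n≡m {m} (divides 1 ≡.refl) _ _ = +-identityʳ m
  m∣n∧0<n∧n<2m⇒n≡m {m} (divides (suc (suc q)) ≡.refl) _ n<2m =
    contradiction (*-monoˡ-≤ m {2} {suc (suc q)} (s≤s (s≤s z≤n))) (<⇒≱ n<2m)

  [m+n∸o]%n≡0⇒o≡m : ∀ {m n o} .{{_ : NonZero n}} → m < n → o < n → ((m + n) ∸ o) % n ≡ 0 → o ≡ m
  [m+n∸o]%n≡0⇒o≡m {m} {n} {o} m<n o<n d%n≡0 = +-cancelˡ-≡ n o m (begin
    n + o              ≡⟨ cong (_+ o) d≡n ⟨
    (m + n) ∸ o + o    ≡⟨ m∸n+n≡m (<⇒≤ o<m+n) ⟩
    m + n              ≡⟨ +-comm m n ⟩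
    n + m              ∎)
    where
    o<m+n : o < m + n
    o<m+n = <-≤-trans o<n (m≤n+m n m)
    m+n<2n : m + n < 2 * n
    m+n<2n = <-≤-trans (+-monoˡ-< n m<n) (≤-reflexive (cong (n +_) (≡.sym (+-identityʳ n))))
    d≡n : (m + n) ∸ o ≡ n
    d≡n = m∣n∧0<n∧n<2m⇒n≡m (m%n≡0⇒n∣m _ n d%n≡0) (m<n⇒0<n∸m o<m+n) (≤-<-trans (m∸n≤m (m + n) o) m+n<2n)

module _ where
  open import Data.Integer.Base using (ℤ; +_; _+_; _-_; _*_; _⊖_)
  open import Data.Integer.Properties using (pos-+; pos-*; ⊖-≥; [+m]-[+n]≡m⊖n; distribˡ-⊖-+-pos)
  open import Data.Integer.Divisibility.Signed
    using (_∣_; divides; ∣-refl; ∣-trans; ∣⇒∣ᵤ; ∣ᵤ⇒∣; ∣m∣n⇒∣m+n; ∣m∣n⇒∣m-n; ∣m⇒∣m*n; ∣n⇒∣m*n)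
  open import Data.Integer.Tactic.RingSolver using (solve-∀)
  open import Data.Nat.DivMod using (m≡m%n+[m/n]*n; m%n<n)
  open import Data.Nat.Divisibility using (%-presˡ-∣; n∣m*n) renaming (_∣_ to _ℕ∣_)
  open import Data.Nat.Properties using (n≢0⇒n>0)
  open ≡.≡-Reasoning

  pos-+-* : ∀ a b c → + (a ℕ.+ b ℕ.* c) ≡ + a + + b * + c
  pos-+-* a b c = ≡.trans (pos-+ a (b ℕ.* c)) (cong (_+_ (+ a)) (pos-* b c))

  pos-*-+ : ∀ a b c → + (a ℕ.* b ℕ.+ c) ≡ + a * + b + + c
  pos-*-+ a b c = ≡.trans (pos-+ (a ℕ.* b) c) (cong (_+ + c) (pos-* a b))

  n∣m-m%n : ∀ m n .{{_ : ℕ.NonZero n}} → + n ∣ + m - + (m ℕ.% n)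
  n∣m-m%n m n = divides (+ q) (begin
    + m - + r                ≡⟨ cong (λ t → + t - + r) (m≡m%n+[m/n]*n m n) ⟩
    + (r ℕ.+ q ℕ.* n) - + r  ≡⟨ cong (_- + r) (pos-+-* r q n) ⟩
    + r + + q * + n - + r    ≡⟨ a+b-a≡b (+ r) (+ q * + n) ⟩
    + q * + n                ∎)
    where
    r = m ℕ.% n
    q = m ℕ./ n
    a+b-a≡b : ∀ a b → a + b - a ≡ b
    a+b-a≡b = solve-∀

  n∣v*x+u-app : ∀ n .{{_ : ℕ.NonZero n}} u v x → + n ∣ + v * + x + + u - + app n (u , v) x
  n∣v*x+u-app n@(suc _) u v x =
    ≡.subst (λ t → + n ∣ t - + app n (u , v) x) (pos-*-+ v x u) (n∣m-m%n (v ℕ.* x ℕ.+ u) n)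

  involutive-at-0⇒n∣v*u+u : ∀ n .{{_ : ℕ.NonZero n}} u v → let π = (u , v) in
                            app n π (app n π 0) ≡ 0 → + n ∣ + v * + u + + u
  involutive-at-0⇒n∣v*u+u n u v ππ0≡0 = ≡.subst (+ n ∣_) (identity (+ v) (+ u) (+ π0))
      (∣m∣n⇒∣m+n (≡.subst (λ t → + n ∣ + v * + π0 + + u - + t) ππ0≡0 (n∣v*x+u-app n u v π0))
                  (∣n⇒∣m*n (+ v) (n∣v*x+u-app n u v 0)))
    where
    π0 = app n (u , v) 0
    identity : ∀ v u a → (v * a + u - + 0) + v * (v * + 0 + u - a) ≡ v * u + u
    identity = solve-∀

  midpoint-fixed-mod : ∀ {k h u v j p} → k ≡ + 1 + h * + 2 →
                       k ∣ u * (+ 1 + h) - j → k ∣ v * j + u - p → k ∣ v * u + u → k ∣ j - p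
  midpoint-fixed-mod {h = h} {u} {v} {j} {p} ≡.refl k∣j₀-j k∣vj+u-p k∣vu+u =
    ≡.subst (_ ∣_) (identity h u v j p)
      (∣m∣n⇒∣m+n (∣m∣n⇒∣m-n (∣m∣n⇒∣m+n (∣n⇒∣m*n (v - + 1) k∣j₀-j) (∣m⇒∣m*n u ∣-refl))
                             (∣n⇒∣m*n (+ 1 + h) k∣vu+u))
                 k∣vj+u-p)
    where
    identity : ∀ h u v j p →
      (v - + 1) * (u * (+ 1 + h) - j) + (+ 1 + h * + 2) * u - (+ 1 + h) * (v * u + u) + (v * j + u - p) ≡ j - p
    identity = solve-∀

  quasipolarity⇒∃diffExp≡k : ∀ k .{{_ : ℕ.NonZero k}} {u v} → k ℕ.% 2 ≡ 1 →
                             IsQuasipolarity (2 ℕ.* k) (u , v) →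
                             ∃[ j ] j ℕ.< 2 ℕ.* k × diffExp (2 ℕ.* k) (u , v) j ≡ k
  quasipolarity⇒∃diffExp≡k k@(suc _) {u} {v} k-odd π-quasi = j , j<n , diffExp≡k
    where
    n = 2 ℕ.* k
    π = (u , v)
    h = k ℕ./ 2
    -- 1 + h = (k + 1)/2 inverts 2 modulo k, so j ≡ u/2
    j = u ℕ.* suc h ℕ.% n
    p = app n π j
    j<n : j ℕ.< n
    j<n = m%n<n (u ℕ.* suc h) n
    p<n : p ℕ.< n
    p<n = m%n<n (v ℕ.* j ℕ.+ u) n
    k≡1+2h : + k ≡ + 1 + + h * + 2
    k≡1+2h = ≡.trans (cong +_ (≡.trans (m≡m%n+[m/n]*n k 2) (cong (ℕ._+ h ℕ.* 2) k-odd))) (pos-+-* 1 h 2)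
    k∣n : + k ∣ + n
    k∣n = ∣ᵤ⇒∣ (n∣m*n 2)
    k∣j-p : + k ∣ + j - + p
    k∣j-p = midpoint-fixed-mod {h = + h} {+ u} {+ v} {+ j} {+ p} k≡1+2h
      (∣-trans k∣n (≡.subst (λ t → + n ∣ t - + j) (pos-* u (suc h)) (n∣m-m%n (u ℕ.* suc h) n)))
      (∣-trans k∣n (n∣v*x+u-app n u v j))
      (∣-trans k∣n (involutive-at-0⇒n∣v*u+u n u v (proj₁ (All.lookup π-quasi (∈-upTo⁺ ℕ.z<s)))))
    j-p+n≡j+n∸p : + j - + p + + n ≡ + ((j ℕ.+ n) ℕ.∸ p)
    j-p+n≡j+n∸p = begin
      + j - + p + + n         ≡⟨ cong (_+ + n) ([+m]-[+n]≡m⊖n j p) ⟩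
      j ⊖ p + + n             ≡⟨ distribˡ-⊖-+-pos n j p ⟩
      (j ℕ.+ n) ⊖ p           ≡⟨ ⊖-≥ (ℕₚ.≤-trans (ℕₚ.<⇒≤ p<n) (ℕₚ.m≤n+m n j)) ⟩
      + ((j ℕ.+ n) ℕ.∸ p)     ∎
    k∣j+n∸p : k ℕ∣ (j ℕ.+ n) ℕ.∸ p
    k∣j+n∸p = ∣⇒∣ᵤ (≡.subst (+ k ∣_) j-p+n≡j+n∸p (∣m∣n⇒∣m+n k∣j-p k∣n))
    diffExp≡k : diffExp n π j ≡ k
    diffExp≡k = m∣n∧0<n∧n<2m⇒n≡m (%-presˡ-∣ k∣j+n∸p (n∣m*n 2))
            (n≢0⇒n>0 (λ r≡0 → proj₂ (All.lookup π-quasi (∈-upTo⁺ j<n)) ([m+n∸o]%n≡0⇒o≡m j<n p<n r≡0)))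
            (m%n<n ((j ℕ.+ n) ℕ.∸ p) n)

module _ {c ℓ} (F : Field c ℓ) where
  open Field F
  open import Relation.Binary.Reasoning.Setoid setoid
  open import Algebra.Properties.Ring ring using (x[y-z]≈xy-xz)
  open import Algebra.Properties.Group +-group using (x∙y⁻¹≈ε⇒x≈y)

  ^-homo-* : ∀ x m n → x ^ (m ℕ.+ n) ≈ x ^ m * x ^ n
  ^-homo-* x zero    n = sym (*-identityˡ _)
  ^-homo-* x (suc m) n = trans (*-congˡ (^-homo-* x m n)) (sym (*-assoc _ _ _))

  x*y≈0⇒y≉0⇒x≈0 : ∀ {x y} → x * y ≈ 0# → y ≉ 0# → x ≈ 0#
  x*y≈0⇒y≉0⇒x≈0 {x} {y} xy≈0 y≉0 = begin
    x                ≈⟨ *-identityʳ x ⟨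
    x * 1#           ≈⟨ *-congˡ (inverseʳ y y≉0) ⟨
    x * (y * y ⁻¹)   ≈⟨ *-assoc x y (y ⁻¹) ⟨
    (x * y) * y ⁻¹   ≈⟨ *-congʳ xy≈0 ⟩
    0# * y ⁻¹        ≈⟨ zeroˡ _ ⟩
    0#               ∎

  x*x≈1⇒[1+x]*[x-1]≈0 : ∀ {x} → x * x ≈ 1# → (1# + x) * (x - 1#) ≈ 0#
  x*x≈1⇒[1+x]*[x-1]≈0 {x} xx≈1 = begin
    (1# + x) * (x - 1#)             ≈⟨ x[y-z]≈xy-xz (1# + x) x 1# ⟩
    (1# + x) * x - (1# + x) * 1#    ≈⟨ +-cong (distribʳ x 1# x) (-‿cong (*-identityʳ (1# + x))) ⟩
    (1# * x + x * x) - (1# + x)     ≈⟨ +-congʳ (+-cong (*-identityˡ x) xx≈1) ⟩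
    (x + 1#) - (1# + x)             ≈⟨ +-congʳ (+-comm x 1#) ⟩
    (1# + x) - (1# + x)             ≈⟨ -‿inverseʳ (1# + x) ⟩
    0#                              ∎

  x*x≈1⇒x≉1⇒1+x≈0 : ∀ {x} → x * x ≈ 1# → x ≉ 1# → 1# + x ≈ 0#
  x*x≈1⇒x≉1⇒1+x≈0 {x} xx≈1 x≉1 =
    x*y≈0⇒y≉0⇒x≈0 (x*x≈1⇒[1+x]*[x-1]≈0 xx≈1) (λ x-1≈0 → x≉1 (x∙y⁻¹≈ε⇒x≈y x 1# x-1≈0))

  primitiveRoot⇒1+ζ^k≈0 : ∀ k .{{_ : ℕ.NonZero k}} {ζ} → PrimitiveRoot (2 ℕ.* k) ζ → 1# + ζ ^ k ≈ 0#
  primitiveRoot⇒1+ζ^k≈0 k@(suc _) {ζ} (ζ^2k≈1 , ζ-primitive) = x*x≈1⇒x≉1⇒1+x≈0 ζ^k*ζ^k≈1 ζ^k≉1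
    where
    ζ^k*ζ^k≈1 : ζ ^ k * ζ ^ k ≈ 1#
    ζ^k*ζ^k≈1 = begin
      ζ ^ k * ζ ^ k          ≡⟨ cong (λ m → ζ ^ k * ζ ^ m) (ℕₚ.+-identityʳ k) ⟨
      ζ ^ k * ζ ^ (k ℕ.+ 0)  ≈⟨ ^-homo-* ζ k (k ℕ.+ 0) ⟨
      ζ ^ (2 ℕ.* k)          ≈⟨ ζ^2k≈1 ⟩
      1#                     ∎
    ζ^k≉1 : ζ ^ k ≉ 1#
    ζ^k≉1 = ζ-primitive k ℕ.z<s (ℕₚ.m<m+n k ℕ.z<s)

  ∈⇒prodL-map≈0 : ∀ {A : Set} (f : A → Carrier) {xs a} → a ∈ xs → f a ≈ 0# → prodL (map f xs) ≈ 0#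
  ∈⇒prodL-map≈0 f (here ≡.refl) fa≈0 = trans (*-congʳ fa≈0) (zeroˡ _)
  ∈⇒prodL-map≈0 f (there a∈xs) fa≈0 = trans (*-congˡ (∈⇒prodL-map≈0 f a∈xs fa≈0)) (zeroʳ _)

  All⇒sumL-map≈0 : ∀ {A : Set} (f : A → Carrier) {xs} → All (λ a → f a ≈ 0#) xs → sumL (map f xs) ≈ 0#
  All⇒sumL-map≈0 f []            = refl
  All⇒sumL-map≈0 f (fa≈0 ∷ rest) = trans (+-cong fa≈0 (All⇒sumL-map≈0 f rest)) (+-identityˡ 0#)

  quasipolarity-product≈0 : ∀ k .{{_ : ℕ.NonZero k}} {ζ} → k ℕ.% 2 ≡ 1 → PrimitiveRoot (2 ℕ.* k) ζ →
    ∀ {π} → IsQuasipolarity (2 ℕ.* k) π →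
    prodL (map (λ j → (1# + ζ ^ diffExp (2 ℕ.* k) π j) * (1# - ζ ^ diffExp (2 ℕ.* k) π j) ⁻¹)
               (upTo (2 ℕ.* k))) ≈ 0#
  quasipolarity-product≈0 k {ζ} k-odd ζ-primitive {π@(u , v)} π-quasi
    with quasipolarity⇒∃diffExp≡k k {u} {v} k-odd π-quasi
  ... | j , j<2k , diffExp≡k = ∈⇒prodL-map≈0 _ (∈-upTo⁺ j<2k) (begin
    (1# + ζ ^ d) * y   ≡⟨ cong (λ e → (1# + ζ ^ e) * y) diffExp≡k ⟩
    (1# + ζ ^ k) * y   ≈⟨ *-congʳ (primitiveRoot⇒1+ζ^k≈0 k ζ-primitive) ⟩
    0# * y             ≈⟨ zeroˡ y ⟩
    0#                 ∎)
    where
    d = diffExp (2 ℕ.* k) π j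
    y = (1# - ζ ^ d) ⁻¹

open import Data.Nat using (_*_)
open import Data.Nat.DivMod using (_%_)

theorem1 : ∀ {c ℓ} (F : Field c ℓ) → Field.CharZero F →
           (k : ℕ) → k % 2 ≡ 1 →
           (ζ : Field.Carrier F) → Field.PrimitiveRoot F (2 * k) ζ →
           Field._≈_ F (quasipolaritySum F (2 * k) ζ) (Field.0# F)
theorem1 F _ zero () _ _
theorem1 F _ k@(suc _) k-odd ζ ζ-primitive =
  All⇒sumL-map≈0 F _ (All.map (λ {π} → quasipolarity-product≈0 F k k-odd ζ-primitive {π})
                             (all-filter (isQuasipolarity? (2 * k)) (affineGroup (2 * k))))
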